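{- For every base $\mathcal{B}$, atomic multiset $L$ and formula $\varphi$: if $\Vdash^{L}_{\mathcal{B}}\,!\varphi$, then $\Vdash^{L}_{\mathcal{B}}1$.
   Context: Fix a set $\mathbb{A}$ of propositional atoms. All multisets are finite; $\uplus$ denotes multiset union; an atomic multiset is a finite multiset of atoms. Formulae: $\varphi ::= p\in\mathbb{A}\mid\top\mid 0\mid 1\mid\varphi\multimap\varphi\mid\varphi\otimes\varphi\mid\varphi\mathbin{\&}\varphi\mid\varphi\oplus\varphi\mid\,!\varphi$. Bases. An atomic sequent is a pair $P\Rightarrow p$ ($P$ atomic multiset, $p$ atom); an atomic box is a finite multiset of atomic sequents; an atomic rule is a triple $\langle\mathbf{A},\mathbf{S},p\rangle$ with $\mathbf{A}$ a finite multiset of atomic boxes, $\mathbf{S}$ an atomic box, $p$ an atom. A base is a set of atomic rules; $\mathcal{C}\supseteq\mathcal{B}$ is set inclusion. An atom $p$ is persistent in $\mathcal{B}$ if $\mathcal{B}$ contains a rule $\langle\varnothing,\mathbf{S},p\rangle$ with $\mathbf{S}\neq\varnothing$. Derivability $P\vdash_{\mathcal{B}}p$ is the smallest relation closed under: (Ref) $\{p\}\vdash_{\mathcal{B}}p$; (App) if $\langle\mathbf{A},\mathbf{S},p\rangle\in\mathcal{B}$ with $\mathbf{A}=\{\mathbf{T}_1,\dots,\mathbf{T}_m\}$, and there are $n\ge m$, atomic multisets $C_1,\dots,C_n$ and a multiset $D=\{d_{m+1},\dots,d_n\}$ of atoms persistent in $\mathcal{B}$ with $C_i\uplus Q\vdash_{\mathcal{B}}q$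 for all $i\le m$ and $Q\Rightarrow q\in\mathbf{T}_i$, $C_j\vdash_{\mathcal{B}}d_j$ for all $m<j\le n$, and $D\uplus U\vdash_{\mathcal{B}}v$ for all $U\Rightarrow v\in\mathbf{S}$, then $C_1\uplus\dots\uplus C_n\vdash_{\mathcal{B}}p$. Support. For a base $\mathcal{B}$, atomic multiset $L$: (At) $\Vdash^L_{\mathcal{B}}p$ iff $L\vdash_{\mathcal{B}}p$; ($\multimap$) $\Vdash^L_{\mathcal{B}}\varphi\multimap\psi$ iff $\varphi\Vdash^L_{\mathcal{B}}\psi$; ($\otimes$) $\Vdash^L_{\mathcal{B}}\varphi\otimes\psi$ iff for all $\mathcal{C}\supseteq\mathcal{B}$, atomic multisets $K$, atoms $p$: if $\{\varphi,\psi\}\Vdash^K_{\mathcal{C}}p$ then $\Vdash^{L\uplus K}_{\mathcal{C}}p$; ($1$) $\Vdash^L_{\mathcal{B}}1$ iff for all $\mathcal{C}\supseteq\mathcal{B}$, $K$, $p$: if $\Vdash^K_{\mathcal{C}}p$ then $\Vdash^{L\uplus K}_{\mathcal{C}}p$; ($\mathbin{\&}$) $\Vdash^L_{\mathcal{B}}\varphi\mathbin{\&}\psi$ iff $\Vdash^L_{\mathcal{B}}\varphi$ and $\Vdash^L_{\mathcal{B}}\psi$; ($\oplus$) $\Vdash^L_{\mathcal{B}}\varphi\oplus\psi$ iff for all $\mathcal{C}\supseteq\mathcal{B}$, $K$, $p$: if $\varphi\Vdash^K_{\mathcal{C}}p$ and $\psi\Vdash^K_{\mathcal{C}}p$ then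 $\Vdash^{L\uplus K}_{\mathcal{C}}p$; ($0$) $\Vdash^L_{\mathcal{B}}0$ iff $\Vdash^{L\uplus K}_{\mathcal{B}}p$ for all atoms $p$ and atomic multisets $K$; ($\top$) $\Vdash^L_{\mathcal{B}}\top$ always; ($!$) $\Vdash^L_{\mathcal{B}}\,!\varphi$ iff for all $\mathcal{C}\supseteq\mathcal{B}$, $K$, $p$: if (for all $\mathcal{D}\supseteq\mathcal{C}$, $\Vdash^{\varnothing}_{\mathcal{D}}\varphi$ implies $\Vdash^K_{\mathcal{D}}p$) then $\Vdash^{L\uplus K}_{\mathcal{C}}p$. Multisets: $\Vdash^L_{\mathcal{B}}\varnothing$ iff $L=\varnothing$; $\Vdash^L_{\mathcal{B}}\{\varphi\}$ iff $\Vdash^L_{\mathcal{B}}\varphi$; $\Vdash^L_{\mathcal{B}}\Gamma\uplus\Delta$ iff $L=K\uplus M$ for some $K,M$ with $\Vdash^K_{\mathcal{B}}\Gamma$, $\Vdash^M_{\mathcal{B}}\Delta$. (Inf) For non-empty $\Gamma$, write $\Gamma=\,!\Delta\uplus\Theta$ with $!\Delta$ the elements whose top-level connective is $!$ and $\Theta$ the rest; $\Gamma\Vdash^L_{\mathcal{B}}\varphi$ iff for all $\mathcal{C}\supseteq\mathcal{B}$ and atomic $K$: if $\Vdash^{\varnothing}_{\mathcal{C}}\delta$ for every $\delta\in\Delta$ and $\Vdash^K_{\mathcal{C}}\Theta$, then $\Vdash^{L\uplus K}_{\mathcal{C}}\varphi$. For $\Gamma=\varnothing$, $\Gamma\Vdash^L_{\mathcal{B}}\varphi$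 means $\Vdash^L_{\mathcal{B}}\varphi$. -}

module Defs where

open import Level using (Level; Lift; lift) renaming (suc to lsuc; zero to lzero)
open import Data.List using (List; []; _∷_; _++_; concat; map)
open import Data.List.Membership.Propositional using (_∈_)
open import Data.List.Relation.Unary.All using (All)
open import Data.List.Relation.Binary.Pointwise using (Pointwise)
open import Data.List.Relation.Binary.Permutation.Propositional using (_↭_)
open import Data.Product using (Σ; ∃; ∃-syntax; _×_; _,_; proj₁; proj₂)
open import Data.Unit using (⊤)
open import Relation.Binary.PropositionalEquality using (_≡_)
open import Relation.Nullary using (¬_)

module _ (Atom : Set) where


  -- Atomic multisets are represented by lists; multiset equality is
  -- permutation (_↭_).
  AtMS : Set
  AtMS = List Atom

  record Sequent : Set where
    constructor _⇒_
    field
      ctx  : AtMS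
      goal : Atom
  open Sequent public

  Box : Set
  Box = List Sequent

  record Rule : Set where
    constructor ⟨_,_,_⟩
    field
      premises : List Box
      discharge : Box
      head : Atom
  open Rule public

  Base : Set₁
  Base = Rule → Set

  _⊆_ : Base → Base → Set
  B ⊆ C = ∀ r → B r → C r

  Persistent : Base → Atom → Set
  Persistent B p = Σ Box λ S → ¬ (S ≡ []) × B ⟨ [] , S , p ⟩

  data Derives (B : Base) : AtMS → Atom → Set where
    ref : ∀ {p} → Derives B (p ∷ []) p
    app : ∀ {A S p L} → B ⟨ A , S , p ⟩ →
          (Cs : List AtMS) →
          Pointwise (λ T C → ∀ {s} → s ∈ T → Derives B (C ++ ctx s) (goal s)) A Cs →
          (Es : List (AtMS × Atom)) →
          All (λ e → Persistent B (proj₂ e)) Es →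
          All (λ e → Derives B (proj₁ e) (proj₂ e)) Es →
          -- D ⊎ U ⊢ v for every U ⇒ v in S, where D = {d_{m+1},…,dₙ}
          (∀ {s} → s ∈ S → Derives B (map proj₂ Es ++ ctx s) (goal s)) →
          L ↭ (concat Cs ++ concat (map proj₁ Es)) →
          Derives B L p

  infixr 5 _⊸_
  infixr 6 _⊗_ _&_ _⊕_
  data Formula : Set where
    atom : Atom → Formula
    ⊤′ 𝟘 𝟙 : Formula
    _⊸_ _⊗_ _&_ _⊕_ : Formula → Formula → Formula
    !_ : Formula → Formula

  At : Base → AtMS → Atom → Set₁
  At B L p = Lift (lsuc lzero) (Derives B L p)

  -- An element of a context Γ, seen from a base C: either it is !δ, and
  -- contributes the condition ⊩^∅_C δ, or it is some θ in Θ, and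
  -- contributes the predicate K ↦ ⊩^K_C θ.
  data Entry : Set₂ where
    bang : Set₁ → Entry
    lin  : (AtMS → Set₁) → Entry

  -- Hyps es K :  ⊩^∅_C δ for every δ ∈ Δ and ⊩^K_C Θ  (multiset support of Θ)
  Hyps : List Entry → AtMS → Set₁
  Hyps [] K = Lift (lsuc lzero) (K ≡ [])
  Hyps (bang P ∷ es) K = P × Hyps es K
  Hyps (lin Q ∷ es) K = Σ AtMS λ K₁ → Σ AtMS λ K₂ → Lift (lsuc lzero) (K ↭ (K₁ ++ K₂)) × Q K₁ × Hyps es K₂

  -- Γ ⊩^K_C p for an atom p, with Γ described by entries (clause (Inf))
  InfAt : Base → AtMS → (Base → List Entry) → Atom → Set₁
  InfAt C K es p = ∀ D → C ⊆ D → ∀ K′ → Hyps (es D) K′ → At D (K ++ K′) p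

  mutual
    entry : Base → Formula → Entry
    entry C (! δ) = bang (supp C [] δ)
    entry C (atom p) = lin (λ K → supp C K (atom p))
    entry C ⊤′ = lin (λ K → supp C K ⊤′)
    entry C 𝟘 = lin (λ K → supp C K 𝟘)
    entry C 𝟙 = lin (λ K → supp C K 𝟙)
    entry C (φ ⊸ ψ) = lin (λ K → supp C K (φ ⊸ ψ))
    entry C (φ ⊗ ψ) = lin (λ K → supp C K (φ ⊗ ψ))
    entry C (φ & ψ) = lin (λ K → supp C K (φ & ψ))
    entry C (φ ⊕ ψ) = lin (λ K → supp C K (φ ⊕ ψ))

    supp : Base → AtMS → Formula → Set₁
    supp B L (atom p) = At B L p
    supp B L (φ ⊸ ψ) =
      ∀ C → B ⊆ C → ∀ K → Hyps (entry C φ ∷ []) K → supp C (L ++ K) ψ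
    supp B L (φ ⊗ ψ) =
      ∀ C → B ⊆ C → ∀ K p →
        InfAt C K (λ D → entry D φ ∷ entry D ψ ∷ []) p → At C (L ++ K) p
    supp B L 𝟙 = ∀ C → B ⊆ C → ∀ K p → At C K p → At C (L ++ K) p
    supp B L (φ & ψ) = supp B L φ × supp B L ψ
    supp B L (φ ⊕ ψ) =
      ∀ C → B ⊆ C → ∀ K p →
        InfAt C K (λ D → entry D φ ∷ []) p →
        InfAt C K (λ D → entry D ψ ∷ []) p → At C (L ++ K) p
    supp B L 𝟘 = ∀ p K → At B (L ++ K) p
    supp B L ⊤′ = Lift (lsuc lzero) ⊤
    supp B L (! φ) =
      ∀ C → B ⊆ C → ∀ K p →
        (∀ D → C ⊆ D → supp D [] φ → At D K p) → At C (L ++ K) p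

{-# OPTIONS --safe #-}
-- Atomic support is monotone under base extension.  So if ⊩^K_C p, the
-- premise of the (!) clause holds at C for K and p whatever φ is (every
-- D ⊇ C supports p with K), and the (!) clause gives ⊩^(L ⊎ K)_C p,
-- which is what the (1) clause asks for.
module Submission where

open import Defs
open import Data.List using (List; _++_)
open import Data.List.Membership.Propositional using (_∈_)
open import Data.List.Relation.Unary.All as All using (All; []; _∷_)
open import Data.List.Relation.Binary.Pointwise using (Pointwise; []; _∷_)
open import Data.Product using (_×_; _,_; proj₁; proj₂)
open import Level using (lift)

module _ {Atom : Set} {B C : Base Atom} (B⊆C : _⊆_ Atom B C) where

  Persistent-mono : ∀ {p} → Persistent Atom B p → Persistent Atom C p
  Persistent-mono (S , S≢[] , rule∈B) = S , S≢[] , B⊆C _ rule∈B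

  -- The premise lists are mapped by hand rather than with Pointwise.map and
  -- All.map, so that the termination checker sees the recursive calls.
  mutual
    Derives-mono : ∀ {L p} → Derives Atom B L p → Derives Atom C L p
    Derives-mono ref = ref
    Derives-mono (app rule∈B Cs boxes Es persistent side discharge L↭) =
      app (B⊆C _ rule∈B) Cs (boxes-mono boxes) Es
          (All.map Persistent-mono persistent) (side-mono side)
          (λ s∈S → Derives-mono (discharge s∈S)) L↭

    boxes-mono : ∀ {As Cs} →
      Pointwise (λ T K → ∀ {s} → s ∈ T → Derives Atom B (K ++ ctx s) (goal s)) As Cs →
      Pointwise (λ T K → ∀ {s} → s ∈ T → Derives Atom C (K ++ ctx s) (goal s)) As Cs
    boxes-mono [] = []
    boxes-mono (box ∷ boxes) = (λ s∈T → Derives-mono (box s∈T)) ∷ boxes-mono boxes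

    side-mono : ∀ {Es : List (AtMS Atom × Atom)} →
      All (λ e → Derives Atom B (proj₁ e) (proj₂ e)) Es →
      All (λ e → Derives Atom C (proj₁ e) (proj₂ e)) Es
    side-mono [] = []
    side-mono (d ∷ ds) = Derives-mono d ∷ side-mono ds

  At-mono : ∀ {L p} → At Atom B L p → At Atom C L p
  At-mono (lift d) = lift (Derives-mono d)

mainTheorem19 : (Atom : Set) (B : Base Atom) (L : List Atom) (φ : Formula Atom) →
    supp Atom B L (! φ) → supp Atom B L (𝟙 {Atom})
mainTheorem19 Atom B L φ ⊩!φ C B⊆C K p ⊩p =
  ⊩!φ C B⊆C K p (λ D C⊆D _ → At-mono C⊆D ⊩p)
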